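{- Over the binary alphabet $V = \{a, b\}$, the language $Q_{\overline{I}}$ is not context-free.
   Context: $V^*$ is the set of all finite words over $V$. A nonempty word $w$ is primitive if it is not of the form $v^n$ for a word $v$ and an integer $n \ge 2$; $Q$ is the set of primitive words over $V$. For a word $w$ of length $n$, $w[1..i]$ denotes its prefix of length $i$ and $w[i+1..n]$ its suffix of length $n-i$. A primitive word $w$ of length $n$ is ins-robust if for every $i \in \{0,\ldots,n\}$ and every $c \in V$ the word $w[1..i]\,c\,w[i+1..n]$ is primitive; $Q_I$ is the set of ins-robust primitive words and $Q_{\overline{I}} = Q \setminus Q_I$. -}

module Defs where

open import Data.Nat using (ℕ; _≤_)
open import Data.Fin using (Fin)
open import Data.List using (List; []; _∷_; _++_; concat; replicate; length; take; drop)
open import Data.List.Membership.Propositional using (_∈_)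
open import Data.Product using (Σ; ∃; _×_; _,_)
open import Data.Sum using (_⊎_; inj₁; inj₂)
open import Relation.Binary.PropositionalEquality using (_≡_; _≢_)
open import Relation.Nullary using (¬_)
open import Function.Bundles using (_⇔_)

data V : Set where
  a b : V

Word : Set
Word = List V

Language : Set₁
Language = Word → Set

_^_ : Word → ℕ → Word
v ^ n = concat (replicate n v)

Primitive : Word → Set
Primitive w = (w ≢ []) × ¬ (Σ Word λ v → Σ ℕ λ n → (2 ≤ n) × (w ≡ v ^ n))

insertAt : ℕ → V → Word → Word
insertAt i c w = take i w ++ (c ∷ drop i w)

InsRobust : Word → Set
InsRobust w = Primitive w × ((i : ℕ) → i ≤ length w → (c : V) → Primitive (insertAt i c w))

QIbar : Language
QIbar w = Primitive w × ¬ InsRobust w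

record CFG : Set where
  field
    nN    : ℕ
    start : Fin nN
    rules : List (Fin nN × List (V ⊎ Fin nN))

data Derives (G : CFG) : List (V ⊎ Fin (CFG.nN G)) → Word → Set where
  nil  : Derives G [] []
  term : ∀ {c α w} → Derives G α w → Derives G (inj₁ c ∷ α) (c ∷ w)
  nont : ∀ {A β α u w} → (A , β) ∈ CFG.rules G →
         Derives G β u → Derives G α w → Derives G (inj₂ A ∷ α) (u ++ w)

Lang : CFG → Language
Lang G w = Derives G (inj₂ (CFG.start G) ∷ []) w

ContextFree : Language → Set
ContextFree L = Σ CFG λ G → (w : Word) → Lang G w ⇔ L w

-- The witness a^n b (a^(n+1) b)^4 lies in Q_Ī: it is primitive, and inserting a in front gives (a^(n+1) b)^5.
-- Words over {a, b} are compared through their cyclic gap lists, the lengths of the a-runs between cyclically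
-- consecutive b's: these are invariant under rotation, and the gap list of v^k is the k-th power of that of v.
-- Pumping the witness down, with n = 2p + 3 for the pumping length p, deletes between 1 and p letters: either
-- only a's, shortening at most two adjacent gaps, or a single b, merging two gaps into one long gap. After any
-- one-letter insertion into the result, the gap list cannot be a proper power: some count over it (long gaps,
-- cyclic ascents across p + 3) equals 1, or it has length 5 while its sum is too small for five equal gaps.
-- So the pumped-down word is ins-robust, contradicting the pumping lemma.
module Submission where

open import Defs
open import Relation.Nullary using (¬_; Dec; yes; no; contradiction)

open import Data.Empty using (⊥; ⊥-elim)
open import Data.Fin using (Fin) renaming (_≟_ to _≟ᶠ_)
open import Data.Fin.Properties using (injective⇒≤)
open import Data.List using (List; []; _∷_; _++_; _∷ʳ_; length; replicate; concat; filter; take; drop; map; lookup)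
open import Data.List.Membership.Propositional using (_∈_; _∉_)
open import Data.List.Membership.Propositional.Properties using (∈-lookup; ∈-map⁺)
open import Data.List.Properties
  using (++-assoc; ++-identityʳ; ++-conicalˡ; ++-conicalʳ; ∷-injective; length-++; length-replicate; take++drop≡id;
         filter-++; length-filter; filter-accept; filter-reject; filter-none; filter-all)
open import Data.List.Relation.Binary.Permutation.Propositional
  using (_↭_; ↭-refl; ↭-reflexive; ↭-trans; module PermutationReasoning)
open import Data.List.Relation.Binary.Permutation.Propositional.Properties using (filter-↭; ↭-length; ++-comm; All-resp-↭)
open import Data.List.Relation.Unary.All using (All; []; _∷_)
import Data.List.Relation.Unary.All as All
open import Data.List.Relation.Unary.All.Properties using (∷ʳ⁻; ∷ʳ⁺; ++⁻ʳ)
open import Data.List.Relation.Unary.All.Properties.Core using (¬Any⇒All¬)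
open import Data.List.Relation.Unary.AllPairs using ([]; _∷_)
open import Data.List.Relation.Unary.Any using (here; there)
open import Data.List.Relation.Unary.Unique.Propositional using (Unique)
open import Data.Nat renaming (_^_ to _^ℕ_)
open import Data.Nat.Divisibility using (divides)
open import Data.Nat.ListAction using (sum)
open import Data.Nat.ListAction.Properties using (sum-++; sum-↭)
open import Data.Nat.Primality using (prime?; prime⇒irreducible)
open import Data.Nat.Properties
open import Algebra.Properties.CommutativeSemigroup +-commutativeSemigroup using (xy∙z≈xz∙y)
open import Data.Nat.Tactic.RingSolver using (solve-∀)
open import Data.Product using (Σ; _×_; _,_; proj₁; proj₂)
open import Data.Sum using (_⊎_; inj₁; inj₂; [_,_]′)
open import Function using (_∘_)
open import Function.Bundles using (Equivalence)
open import Level using (0ℓ)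
open import Relation.Binary.PropositionalEquality
open import Relation.Nullary.Decidable using (toWitness; _×-dec_)
open import Relation.Unary using (Pred; Decidable)

private
  variable
    A : Set

infixr 8 _^*_

_^*_ : List A → ℕ → List A
xs ^* k = concat (replicate k xs)

[]-^* : ∀ k → ([] {A = A}) ^* k ≡ []
[]-^* zero    = refl
[]-^* (suc k) = []-^* k

^*-snoc : ∀ (xs : List A) k → xs ^* k ++ xs ≡ xs ++ xs ^* k
^*-snoc xs zero    = sym (++-identityʳ xs)
^*-snoc xs (suc k) = trans (++-assoc xs (xs ^* k) xs) (cong (xs ++_) (^*-snoc xs k))

^*-shift : ∀ (ys zs : List A) k → (ys ++ zs) ^* k ++ ys ≡ ys ++ (zs ++ ys) ^* k
^*-shift ys zs zero    = sym (++-identityʳ ys)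
^*-shift ys zs (suc k) = begin
  ((ys ++ zs) ++ (ys ++ zs) ^* k) ++ ys ≡⟨ ++-assoc (ys ++ zs) _ ys ⟩
  (ys ++ zs) ++ (ys ++ zs) ^* k ++ ys   ≡⟨ cong ((ys ++ zs) ++_) (^*-shift ys zs k) ⟩
  (ys ++ zs) ++ ys ++ (zs ++ ys) ^* k   ≡⟨ ++-assoc ys zs _ ⟩
  ys ++ zs ++ ys ++ (zs ++ ys) ^* k     ≡⟨ cong (ys ++_) (++-assoc zs ys _) ⟨
  ys ++ (zs ++ ys) ++ (zs ++ ys) ^* k   ∎
  where open ≡-Reasoning

length-^* : ∀ (xs : List A) k → length (xs ^* k) ≡ k * length xs
length-^* xs zero    = refl
length-^* xs (suc k) = trans (length-++ xs) (cong (length xs +_) (length-^* xs k))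

^*-rotate : ∀ (c : A) v k → (v ++ (c ∷ v) ^* k) ∷ʳ c ≡ (v ∷ʳ c) ^* suc k
^*-rotate c v k = begin
  (v ++ (c ∷ v) ^* k) ∷ʳ c      ≡⟨ ++-assoc v _ _ ⟩
  v ++ (c ∷ v) ^* k ++ c ∷ []   ≡⟨ cong (v ++_) (^*-shift (c ∷ []) v k) ⟩
  v ++ c ∷ (v ∷ʳ c) ^* k        ≡⟨ ++-assoc v (c ∷ []) _ ⟨
  (v ∷ʳ c) ^* suc k             ∎
  where open ≡-Reasoning

^*-conjugate : ∀ (p q v : List A) k → p ++ q ≡ v ^* k → Σ (List A) λ v′ → q ++ p ≡ v′ ^* k
^*-conjugate []      q v       k       eq = v , trans (++-identityʳ q) eq
^*-conjugate (c ∷ p) q v       zero    ()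
^*-conjugate (c ∷ p) q []      (suc k) eq with () ← trans eq ([]-^* k)
^*-conjugate (c ∷ p) q (_ ∷ v) (suc k) eq with refl , eq′ ← ∷-injective eq
  with v′ , eq″ ← ^*-conjugate p (q ∷ʳ c) (v ∷ʳ c) (suc k)
                    (trans (sym (++-assoc p q _)) (trans (cong (_∷ʳ c) eq′) (^*-rotate c v k)))
  = v′ , trans (sym (++-assoc q (c ∷ []) p)) eq″

length-∷ʳ : ∀ (xs : List A) x → length (xs ∷ʳ x) ≡ suc (length xs)
length-∷ʳ xs x = trans (length-++ xs) (+-comm (length xs) 1)

sum-∷ʳ : ∀ xs x → sum (xs ∷ʳ x) ≡ sum xs + x
sum-∷ʳ xs x = trans (sum-++ xs (x ∷ [])) (cong (sum xs +_) (+-identityʳ x))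

sum-∷ʳ-∷ʳ : ∀ gs x y → sum ((gs ∷ʳ x) ∷ʳ y) ≡ sum gs + x + y
sum-∷ʳ-∷ʳ gs x y = trans (sum-∷ʳ (gs ∷ʳ x) y) (cong (_+ y) (sum-∷ʳ gs x))

length-∷ʳ-∷ʳ : ∀ (gs : List A) x y → length ((gs ∷ʳ x) ∷ʳ y) ≡ suc (suc (length gs))
length-∷ʳ-∷ʳ gs x y = trans (length-∷ʳ (gs ∷ʳ x) y) (cong suc (length-∷ʳ gs x))

count : {P : Pred A 0ℓ} → Decidable P → List A → ℕ
count P? xs = length (filter P? xs)

module _ {P : Pred A 0ℓ} (P? : Decidable P) where

  count-++ : ∀ xs ys → count P? (xs ++ ys) ≡ count P? xs + count P? ys
  count-++ xs ys = trans (cong length (filter-++ P? xs ys)) (length-++ (filter P? xs))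

  count-^* : ∀ xs k → count P? (xs ^* k) ≡ k * count P? xs
  count-^* xs zero    = refl
  count-^* xs (suc k) = trans (count-++ xs (xs ^* k)) (cong (count P? xs +_) (count-^* xs k))

  count-↭ : ∀ {xs ys} → xs ↭ ys → count P? xs ≡ count P? ys
  count-↭ p = ↭-length (filter-↭ P? p)

  count-accept : ∀ {x} → P x → count P? (x ∷ []) ≡ 1
  count-accept px = cong length (filter-accept P? px)

  count-reject : ∀ {x} → ¬ P x → count P? (x ∷ []) ≡ 0
  count-reject ¬px = cong length (filter-reject P? ¬px)

  1≤count-^* : ∀ xs k → 1 ≤ count P? (xs ^* k) → k ≤ count P? (xs ^* k)
  1≤count-^* xs k 1≤c with count P? xs | count-^* xs k
  ... | zero  | eq = contradiction (≤-trans 1≤c (≤-reflexive (trans eq (*-zeroʳ k)))) λ ()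
  ... | suc c | eq = ≤-trans (m≤m*n k (suc c)) (≤-reflexive (sym eq))

  count-∷ʳ-≤ : ∀ xs x → count P? xs ≤ count P? (xs ∷ʳ x)
  count-∷ʳ-≤ xs x = ≤-trans (m≤m+n _ _) (≤-reflexive (sym (count-++ xs (x ∷ []))))

  count-∷ʳ-≤-suc : ∀ xs x → count P? (xs ∷ʳ x) ≤ suc (count P? xs)
  count-∷ʳ-≤-suc xs x = begin
    count P? (xs ∷ʳ x)                ≡⟨ count-++ xs (x ∷ []) ⟩
    count P? xs + count P? (x ∷ [])   ≤⟨ +-monoʳ-≤ (count P? xs) (length-filter P? (x ∷ [])) ⟩
    count P? xs + 1                   ≡⟨ +-comm _ 1 ⟩
    suc (count P? xs)                 ∎
    where open ≤-Reasoning

  count-^*-≢-1 : ∀ {L} xs k → L ≡ xs ^* k → 2 ≤ k → count P? L ≢ 1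
  count-^*-≢-1 xs k refl 2≤k eq with count P? xs | count-^* xs k
  ... | zero  | eq′ = contradiction (trans (sym eq) (trans eq′ (*-zeroʳ k))) λ ()
  ... | suc c | eq′ = contradiction (≤-trans 2≤k (≤-trans (m≤m*n k (suc c)) (≤-reflexive (trans (sym eq′) eq)))) λ { (s≤s ()) }

*-count-≤-sum : ∀ t xs → t * count (t ≤?_) xs ≤ sum xs
*-count-≤-sum t []       = ≤-reflexive (*-zeroʳ t)
*-count-≤-sum t (x ∷ xs) = begin
  t * count (t ≤?_) (x ∷ xs)                          ≡⟨ cong (t *_) (count-++ (t ≤?_) (x ∷ []) xs) ⟩
  t * (count (t ≤?_) (x ∷ []) + count (t ≤?_) xs)     ≡⟨ *-distribˡ-+ t _ _ ⟩
  t * count (t ≤?_) (x ∷ []) + t * count (t ≤?_) xs   ≤⟨ +-mono-≤ head-bound (*-count-≤-sum t xs) ⟩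
  x + sum xs                                          ∎
  where
  open ≤-Reasoning
  head-bound : t * count (t ≤?_) (x ∷ []) ≤ x
  head-bound with t ≤? x
  ... | yes t≤x = ≤-trans (≤-reflexive (cong (t *_) (count-accept (t ≤?_) t≤x))) (≤-trans (≤-reflexive (*-identityʳ t)) t≤x)
  ... | no t≰x  = ≤-trans (≤-reflexive (trans (cong (t *_) (count-reject (t ≤?_) t≰x)) (*-zeroʳ t))) z≤n

exponent-of-length-5 : ∀ (xs : List A) k → length (xs ^* k) ≡ 5 → 2 ≤ k → k ≡ 5
exponent-of-length-5 xs k len 2≤k
  with prime⇒irreducible (toWitness {a? = prime? 5} _) (divides (length xs) (trans (sym len) (trans (length-^* xs k) (*-comm k _))))
... | inj₁ refl = contradiction 2≤k λ { (s≤s ()) }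
... | inj₂ k≡5  = k≡5

power-of-length-5 : ∀ t {L} xs k → L ≡ xs ^* k → 2 ≤ k → length L ≡ 5 → 1 ≤ count (t ≤?_) L → 5 * t ≤ sum L
power-of-length-5 t xs k refl 2≤k len 1≤c = begin
  5 * t                      ≡⟨ cong (_* t) (exponent-of-length-5 xs k len 2≤k) ⟨
  k * t                      ≤⟨ *-monoˡ-≤ t (1≤count-^* (t ≤?_) xs k 1≤c) ⟩
  count (t ≤?_) (xs ^* k) * t ≡⟨ *-comm _ t ⟩
  t * count (t ≤?_) (xs ^* k) ≤⟨ *-count-≤-sum t (xs ^* k) ⟩
  sum (xs ^* k)              ∎
  where open ≤-Reasoning

pairsTo : A → List A → List (A × A)
pairsTo h []           = []
pairsTo h (x ∷ [])     = (x , h) ∷ []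
pairsTo h (x ∷ y ∷ xs) = (x , y) ∷ pairsTo h (y ∷ xs)

cyclicPairs : List A → List (A × A)
cyclicPairs []       = []
cyclicPairs (x ∷ xs) = pairsTo x (x ∷ xs)

pairsTo-++ : ∀ (h x : A) xs y ys → pairsTo h ((x ∷ xs) ++ y ∷ ys) ≡ pairsTo y (x ∷ xs) ++ pairsTo h (y ∷ ys)
pairsTo-++ h x []        y ys = refl
pairsTo-++ h x (x′ ∷ xs) y ys = cong ((x , x′) ∷_) (pairsTo-++ h x′ xs y ys)

cyclicPairs-^* : ∀ (x : A) xs k → cyclicPairs ((x ∷ xs) ^* suc k) ≡ cyclicPairs (x ∷ xs) ^* suc k
cyclicPairs-^* x xs zero    = trans (cong (pairsTo x) (++-identityʳ (x ∷ xs))) (sym (++-identityʳ _))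
cyclicPairs-^* x xs (suc k) =
  trans (pairsTo-++ x x xs x (xs ++ (x ∷ xs) ^* k)) (cong (pairsTo x (x ∷ xs) ++_) (cyclicPairs-^* x xs k))

count≤?-mono-∷ʳ : ∀ s gs {g g′} → g ≤ g′ → count (s ≤?_) (gs ∷ʳ g) ≤ count (s ≤?_) (gs ∷ʳ g′)
count≤?-mono-∷ʳ s gs {g} {g′} g≤g′ = begin
  count (s ≤?_) (gs ∷ʳ g)                        ≡⟨ count-++ (s ≤?_) gs _ ⟩
  count (s ≤?_) gs + count (s ≤?_) (g ∷ [])      ≤⟨ +-monoʳ-≤ (count (s ≤?_) gs) last-mono ⟩
  count (s ≤?_) gs + count (s ≤?_) (g′ ∷ [])     ≡⟨ count-++ (s ≤?_) gs _ ⟨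
  count (s ≤?_) (gs ∷ʳ g′)                       ∎
  where
  open ≤-Reasoning
  last-mono : count (s ≤?_) (g ∷ []) ≤ count (s ≤?_) (g′ ∷ [])
  last-mono with s ≤? g
  ... | yes s≤g = ≤-trans (≤-reflexive (count-accept (s ≤?_) s≤g)) (≤-reflexive (sym (count-accept (s ≤?_) (≤-trans s≤g g≤g′))))
  ... | no s≰g  = ≤-trans (≤-reflexive (count-reject (s ≤?_) s≰g)) z≤n

Ascent : ℕ → ℕ × ℕ → Set
Ascent t (x , y) = x < t × t ≤ y

ascent? : ∀ t → Decidable (Ascent t)
ascent? t (x , y) = x <? t ×-dec t ≤? y

ascents-from-high : ∀ t h xs → All (t ≤_) xs → count (ascent? t) (pairsTo h xs) ≡ 0
ascents-from-high t h []           _          = refl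
ascents-from-high t h (x ∷ [])     (t≤x ∷ _)  = count-reject (ascent? t) (λ (x<t , _) → <⇒≱ x<t t≤x)
ascents-from-high t h (x ∷ y ∷ xs) (t≤x ∷ hs) =
  trans (count-++ (ascent? t) ((x , y) ∷ []) _)
        (cong₂ _+_ (count-reject (ascent? t) (λ (x<t , _) → <⇒≱ x<t t≤x)) (ascents-from-high t h (y ∷ xs) hs))

ascents-of-split : ∀ t l f g → t ≤ g → l < t ⊎ f < t → count (ascent? t) ((l , f) ∷ (f , g) ∷ []) ≡ 1
ascents-of-split t l f g t≤g small =
  trans (count-++ (ascent? t) ((l , f) ∷ []) ((f , g) ∷ [])) (by-cases (l <? t) (t ≤? f))
  where
  by-cases : Dec (l < t) → Dec (t ≤ f) → count (ascent? t) ((l , f) ∷ []) + count (ascent? t) ((f , g) ∷ []) ≡ 1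
  by-cases (yes l<t) (yes t≤f) =
    cong₂ _+_ (count-accept (ascent? t) (l<t , t≤f)) (count-reject (ascent? t) (λ (f<t , _) → <⇒≱ f<t t≤f))
  by-cases _ (no t≰f) =
    cong₂ _+_ (count-reject (ascent? t) (λ (_ , t≤f) → t≰f t≤f)) (count-accept (ascent? t) (≰⇒> t≰f , t≤g))
  by-cases (no l≮t) (yes t≤f) = [ (λ l<t → contradiction l<t l≮t) , (λ f<t → contradiction t≤f (<⇒≱ f<t)) ]′ small

cyclicPairs-count-^*-≢-1 : ∀ {B : Set} {P : Pred (B × B) 0ℓ} (P? : Decidable P) {L} xs k →
                           L ≡ xs ^* k → 2 ≤ k → count P? (cyclicPairs L) ≢ 1
cyclicPairs-count-^*-≢-1 P? []       k       eq 2≤k =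
  subst (λ L → count P? (cyclicPairs L) ≢ 1) (sym (trans eq ([]-^* k))) λ ()
cyclicPairs-count-^*-≢-1 P? (x ∷ xs) (suc k) eq 2≤k =
  count-^*-≢-1 P? (cyclicPairs (x ∷ xs)) (suc k) (trans (cong cyclicPairs eq) (cyclicPairs-^* x xs k)) 2≤k



-- The pumping lemma

Unique⇒length≤ : ∀ {n} {xs : List (Fin n)} → Unique xs → length xs ≤ n
Unique⇒length≤ {xs = xs} u = injective⇒≤ (lookup-injective u)
  where
  lookup-injective : ∀ {ys : List (Fin _)} → Unique ys → ∀ {i j} → lookup ys i ≡ lookup ys j → i ≡ j
  lookup-injective (_ ∷ _) {Fin.zero} {Fin.zero} _ = refl
  lookup-injective (x∉ ∷ _) {Fin.zero} {Fin.suc j} eq = contradiction eq (All.lookup x∉ (∈-lookup j))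
  lookup-injective (x∉ ∷ _) {Fin.suc i} {Fin.zero} eq = contradiction (sym eq) (All.lookup x∉ (∈-lookup i))
  lookup-injective (_ ∷ u) {Fin.suc i} {Fin.suc j} eq = cong Fin.suc (lookup-injective u eq)

+-suc-comm : ∀ p q → suc (p + q) ≡ q + suc p
+-suc-comm p q = trans (cong suc (+-comm p q)) (sym (+-suc q p))

++-assoc-infix : ∀ {A : Set} (l x r w : List A) → (l ++ x ++ r) ++ w ≡ l ++ x ++ r ++ w
++-assoc-infix l x r w = trans (++-assoc l _ w) (cong (l ++_) (++-assoc x r w))

∈⇒≤sum : ∀ {n ns} → n ∈ ns → n ≤ sum ns
∈⇒≤sum {ns = n ∷ ns} (here refl) = m≤m+n n (sum ns)
∈⇒≤sum {ns = m ∷ ns} (there p)   = ≤-trans (∈⇒≤sum p) (m≤n+m (sum ns) m)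

length-infix : ∀ {A : Set} (l y r : List A) → length y ≤ length (l ++ y ++ r)
length-infix l y r = begin
  length y                ≤⟨ m≤m+n (length y) (length r) ⟩
  length y + length r     ≡⟨ length-++ y ⟨
  length (y ++ r)         ≤⟨ m≤n+m _ (length l) ⟩
  length l + length (y ++ r) ≡⟨ length-++ l ⟨
  length (l ++ y ++ r)    ∎
  where open ≤-Reasoning


record PumpingDecomposition (G : CFG) (p : ℕ) (w : Word) : Set where
  field
    u v x y z : Word
    split     : w ≡ u ++ (v ++ x ++ y) ++ z
    vy≢ε      : 1 ≤ length (v ++ y)
    |vxy|≤p   : length (v ++ x ++ y) ≤ p
    pump      : ∀ i → Lang G (u ++ ((v ^ i) ++ x ++ (y ^ i)) ++ z)

module Grammar (G : CFG) where
  open CFG G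
  open import Data.List.Membership.DecPropositional (_≟ᶠ_ {nN}) using (_∈?_)

  Symbol : Set
  Symbol = V ⊎ Fin nN

  data Tree (A : Fin nN) (x : Word) : Set where
    node : ∀ {β} → (A , β) ∈ rules → Derives G β x → Tree A x

  size : ∀ {α w} → Derives G α w → ℕ
  size nil          = 0
  size (term d)     = size d
  size (nont _ d e) = suc (size d + size e)

  treeSize : ∀ {A x} → Tree A x → ℕ
  treeSize (node _ d) = suc (size d)

  size-subst : ∀ {α w w′} (eq : w ≡ w′) (d : Derives G α w) → size (subst (Derives G α) eq d) ≡ size d
  size-subst refl d = refl

  -- A derivation of α from which one occurrence of a B-subtree has been cut out.
  data Ctx (B : Fin nN) : List Symbol → Set where
    term  : ∀ {α} (c : V) → Ctx B α → Ctx B (inj₁ c ∷ α)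
    here  : ∀ {α w} → Derives G α w → Ctx B (inj₂ B ∷ α)
    down  : ∀ {A β α w} → (A , β) ∈ rules → Ctx B β → Derives G α w → Ctx B (inj₂ A ∷ α)
    right : ∀ {A β α u} → (A , β) ∈ rules → Derives G β u → Ctx B α → Ctx B (inj₂ A ∷ α)

  yieldˡ yieldʳ : ∀ {B α} → Ctx B α → Word
  yieldˡ (term c C)               = c ∷ yieldˡ C
  yieldˡ (here _)                 = []
  yieldˡ (down _ C _)             = yieldˡ C
  yieldˡ (right {u = u} _ _ C)    = u ++ yieldˡ C
  yieldʳ (term _ C)               = yieldʳ C
  yieldʳ (here {w = w} _)         = w
  yieldʳ (down {w = w} _ C _)     = yieldʳ C ++ w
  yieldʳ (right _ _ C)            = yieldʳ C

  ctxSize : ∀ {B α} → Ctx B α → ℕ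
  ctxSize (term _ C)    = ctxSize C
  ctxSize (here e)      = size e
  ctxSize (down _ C e)  = suc (ctxSize C + size e)
  ctxSize (right _ d C) = suc (size d + ctxSize C)

  plug : ∀ {B α x} (C : Ctx B α) → Tree B x → Derives G α (yieldˡ C ++ x ++ yieldʳ C)
  plug (term c C) t = term (plug C t)
  plug (here e) (node r d) = nont r d e
  plug {x = x} (down {w = w} r C e) t =
    subst (Derives G _) (++-assoc-infix (yieldˡ C) x (yieldʳ C) w) (nont r (plug C t) e)
  plug {x = x} (right {u = u} r d C) t =
    subst (Derives G _) (sym (++-assoc u (yieldˡ C) _)) (nont r d (plug C t))

  size-plug : ∀ {B α x} (C : Ctx B α) (t : Tree B x) → size (plug C t) ≡ ctxSize C + treeSize t
  size-plug (term c C) t = size-plug C t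
  size-plug (here e) (node r d) = +-suc-comm (size d) (size e)
  size-plug (down r C e) t = begin
    size (plug (down r C e) t)                          ≡⟨ size-subst (++-assoc-infix (yieldˡ C) _ (yieldʳ C) _) (nont r (plug C t) e) ⟩
    suc (size (plug C t) + size e)                      ≡⟨ cong (λ s → suc (s + size e)) (size-plug C t) ⟩
    suc (ctxSize C + treeSize t + size e)               ≡⟨ cong suc (xy∙z≈xz∙y (ctxSize C) (treeSize t) (size e)) ⟩
    suc (ctxSize C + size e) + treeSize t               ∎
    where open ≡-Reasoning
  size-plug {x = x} (right {u = u} r d C) t = begin
    size (plug (right r d C) t)                         ≡⟨ size-subst (sym (++-assoc u (yieldˡ C) (x ++ yieldʳ C))) (nont r d (plug C t)) ⟩
    suc (size d + size (plug C t))                      ≡⟨ cong (λ s → suc (size d + s)) (size-plug C t) ⟩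
    suc (size d + (ctxSize C + treeSize t))             ≡⟨ cong suc (+-assoc (size d) _ _) ⟨
    suc (size d + ctxSize C) + treeSize t               ∎
    where open ≡-Reasoning

  compose : ∀ {A B α} → Ctx A α → Ctx B (inj₂ A ∷ []) → Ctx B α
  compose (term c C)    D                = term c (compose C D)
  compose (here e)      (here nil)       = here e
  compose (here e)      (down r D nil)   = down r D e
  compose (down r C e)  D                = down r (compose C D) e
  compose (right r d C) D                = right r d (compose C D)

  yieldˡ-compose : ∀ {A B α} (C : Ctx A α) (D : Ctx B (inj₂ A ∷ [])) →
                   yieldˡ (compose C D) ≡ yieldˡ C ++ yieldˡ D
  yieldˡ-compose (term c C)          D              = cong (c ∷_) (yieldˡ-compose C D)
  yieldˡ-compose (here e)            (here nil)     = refl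
  yieldˡ-compose (here e)            (down r D nil) = refl
  yieldˡ-compose (down r C e)        D              = yieldˡ-compose C D
  yieldˡ-compose (right {u = u} r d C) D            =
    trans (cong (u ++_) (yieldˡ-compose C D)) (sym (++-assoc u _ _))

  yieldʳ-compose : ∀ {A B α} (C : Ctx A α) (D : Ctx B (inj₂ A ∷ [])) →
                   yieldʳ (compose C D) ≡ yieldʳ D ++ yieldʳ C
  yieldʳ-compose (term c C)           D              = yieldʳ-compose C D
  yieldʳ-compose (here e)             (here nil)     = refl
  yieldʳ-compose (here {w = w} e)     (down r D nil) = cong (_++ w) (sym (++-identityʳ (yieldʳ D)))
  yieldʳ-compose (down {w = w} r C e) D              =
    trans (cong (_++ w) (yieldʳ-compose C D)) (++-assoc (yieldʳ D) _ w)
  yieldʳ-compose (right r d C)        D              = yieldʳ-compose C D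

  ctxSize-compose : ∀ {A B α} (C : Ctx A α) (D : Ctx B (inj₂ A ∷ [])) →
                    ctxSize (compose C D) ≡ ctxSize C + ctxSize D
  ctxSize-compose (term c C)    D              = ctxSize-compose C D
  ctxSize-compose (here e)      (here nil)     = sym (+-identityʳ (size e))
  ctxSize-compose (here e)      (down r D nil) =
    trans (cong (λ s → suc (s + size e)) (sym (+-identityʳ (ctxSize D)))) (+-suc-comm (ctxSize D + 0) (size e))
  ctxSize-compose (down r C e)  D              =
    trans (cong (λ s → suc (s + size e)) (ctxSize-compose C D)) (cong suc (xy∙z≈xz∙y (ctxSize C) (ctxSize D) (size e)))
  ctxSize-compose (right r d C) D              =
    trans (cong (λ s → suc (size d + s)) (ctxSize-compose C D)) (cong suc (sym (+-assoc (size d) _ _)))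

  -- The part of a derivation tree between two occurrences of B on one path.
  record Loop (B : Fin nN) : Set where
    constructor loop
    field
      {rhs} : List Symbol
      rule  : (B , rhs) ∈ rules
      ctx   : Ctx B rhs

  loopˡ loopʳ : ∀ {B} → Loop B → Word
  loopˡ (loop _ C) = yieldˡ C
  loopʳ (loop _ C) = yieldʳ C

  iterate : ∀ {B x} (m : Loop B) → Tree B x → ∀ i → Tree B ((loopˡ m ^ i) ++ x ++ (loopʳ m ^ i))
  iterate {x = x} m t zero = subst (Tree _) (sym (++-identityʳ x)) t
  iterate {x = x} m@(loop r C) t (suc i) = subst (Tree _) reassoc (node r (plug C (iterate m t i)))
    where
    v y : Word
    v = loopˡ m
    y = loopʳ m
    reassoc : v ++ ((v ^ i) ++ x ++ (y ^ i)) ++ y ≡ (v ++ (v ^ i)) ++ x ++ (y ++ (y ^ i))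
    reassoc = begin
      v ++ ((v ^ i) ++ x ++ (y ^ i)) ++ y ≡⟨ cong (v ++_) (++-assoc (v ^ i) _ y) ⟩
      v ++ (v ^ i) ++ (x ++ (y ^ i)) ++ y ≡⟨ cong (λ s → v ++ (v ^ i) ++ s) (++-assoc x (y ^ i) y) ⟩
      v ++ (v ^ i) ++ x ++ (y ^ i) ++ y   ≡⟨ cong (λ s → v ++ (v ^ i) ++ x ++ s) (^*-snoc y i) ⟩
      v ++ (v ^ i) ++ x ++ y ++ (y ^ i)   ≡⟨ ++-assoc v (v ^ i) _ ⟨
      (v ++ (v ^ i)) ++ x ++ y ++ (y ^ i) ∎
      where open ≡-Reasoning

  loopSize : ∀ {B} → Loop B → ℕ
  loopSize (loop _ C) = suc (ctxSize C)

  sentential : ∀ {A x} → Tree A x → Derives G (inj₂ A ∷ []) (x ++ [])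
  sentential (node r d) = nont r d nil

  record Occurrence (B : Fin nN) (x : Word) (sx : ℕ) (α : List Symbol) (w : Word) (s : ℕ) : Set where
    constructor occurrence
    field
      ctx   : Ctx B α
      yield : w ≡ yieldˡ ctx ++ x ++ yieldʳ ctx
      sizes : s ≡ ctxSize ctx + sx

  module _ {B : Fin nN} {x : Word} {sx : ℕ} where

    under-term : ∀ {c α w s} → Occurrence B x sx α w s → Occurrence B x sx (inj₁ c ∷ α) (c ∷ w) s
    under-term (occurrence C eq es) = occurrence (term _ C) (cong (_ ∷_) eq) es

    under-head : ∀ {A β α u w s} → (A , β) ∈ rules → (e : Derives G α w) →
                 Occurrence B x sx β u s → Occurrence B x sx (inj₂ A ∷ α) (u ++ w) (suc (s + size e))
    under-head {w = w} r e (occurrence C eq es) = occurrence (down r C e)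
      (trans (cong (_++ w) eq) (++-assoc-infix (yieldˡ C) x (yieldʳ C) w))
      (trans (cong (λ s → suc (s + size e)) es) (cong suc (xy∙z≈xz∙y (ctxSize C) sx (size e))))

    under-tail : ∀ {A β α u w s} → (A , β) ∈ rules → (d : Derives G β u) →
                 Occurrence B x sx α w s → Occurrence B x sx (inj₂ A ∷ α) (u ++ w) (suc (size d + s))
    under-tail {u = u} r d (occurrence C eq es) = occurrence (right r d C)
      (trans (cong (u ++_) eq) (sym (++-assoc u (yieldˡ C) _)))
      (trans (cong (λ s → suc (size d + s)) es) (cong suc (sym (+-assoc (size d) (ctxSize C) sx))))

  at-head : ∀ {B x α w} sx (e : Derives G α w) → Occurrence B x (suc sx) (inj₂ B ∷ α) (x ++ w) (suc (sx + size e))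
  at-head sx e = occurrence (here e) refl (+-suc-comm sx (size e))

  occurrence-trans : ∀ {A B x sx y sy α w s} → Occurrence A x sx α w s →
                     Occurrence B y sy (inj₂ A ∷ []) (x ++ []) (sx + 0) → Occurrence B y sy α w s
  occurrence-trans {x = x} {sx} {y} {sy} {w = w} {s} (occurrence C eqC esC) (occurrence D eqD esD) =
    occurrence (compose C D) yield-eq size-eq
    where
    yield-eq : w ≡ yieldˡ (compose C D) ++ y ++ yieldʳ (compose C D)
    yield-eq = begin
      w                                                        ≡⟨ eqC ⟩
      yieldˡ C ++ x ++ yieldʳ C                                ≡⟨ cong (λ x′ → yieldˡ C ++ x′ ++ yieldʳ C) (trans (sym (++-identityʳ x)) eqD) ⟩
      yieldˡ C ++ (yieldˡ D ++ y ++ yieldʳ D) ++ yieldʳ C      ≡⟨ cong (yieldˡ C ++_) (++-assoc-infix (yieldˡ D) y (yieldʳ D) (yieldʳ C)) ⟩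
      yieldˡ C ++ yieldˡ D ++ y ++ yieldʳ D ++ yieldʳ C        ≡⟨ ++-assoc (yieldˡ C) (yieldˡ D) _ ⟨
      (yieldˡ C ++ yieldˡ D) ++ y ++ yieldʳ D ++ yieldʳ C      ≡⟨ cong₂ (λ l r → l ++ y ++ r) (yieldˡ-compose C D) (yieldʳ-compose C D) ⟨
      yieldˡ (compose C D) ++ y ++ yieldʳ (compose C D)        ∎
      where open ≡-Reasoning
    size-eq : s ≡ ctxSize (compose C D) + sy
    size-eq = begin
      s                                  ≡⟨ esC ⟩
      ctxSize C + sx                     ≡⟨ cong (ctxSize C +_) (trans (sym (+-identityʳ sx)) esD) ⟩
      ctxSize C + (ctxSize D + sy)       ≡⟨ +-assoc (ctxSize C) (ctxSize D) sy ⟨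
      ctxSize C + ctxSize D + sy         ≡⟨ cong (_+ sy) (ctxSize-compose C D) ⟨
      ctxSize (compose C D) + sy         ∎
      where open ≡-Reasoning

  close-loop : ∀ {A β α x sx u w s} (r : (A , β) ∈ rules) (e : Derives G α w) (occ : Occurrence A x sx β u s) →
               Occurrence A (yieldˡ (Occurrence.ctx occ) ++ x ++ yieldʳ (Occurrence.ctx occ))
                          (suc (ctxSize (Occurrence.ctx occ) + sx)) (inj₂ A ∷ α) (u ++ w) (suc (s + size e))
  close-loop {sx = sx} r e (occurrence C refl refl) = at-head (ctxSize C + sx) e

  cut-loop : ∀ {B x α w s} (m : Loop B) (t : Tree B x) → loopˡ m ++ loopʳ m ≡ [] →
             Occurrence B (loopˡ m ++ x ++ loopʳ m) (loopSize m + treeSize t) α w s →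
             Σ (Derives G α w) λ d → size d < s
  cut-loop {x = x} m@(loop _ _) t vy≡ε (occurrence C eq es) =
    subst (Derives G _) (sym eq′) (plug C t) , size-lt
    where
    eq′ : _ ≡ yieldˡ C ++ x ++ yieldʳ C
    eq′ = trans eq (cong (λ x′ → yieldˡ C ++ x′ ++ yieldʳ C) (begin
      loopˡ m ++ x ++ loopʳ m ≡⟨ cong₂ (λ v y → v ++ x ++ y) (++-conicalˡ (loopˡ m) _ vy≡ε) (++-conicalʳ (loopˡ m) _ vy≡ε) ⟩
      x ++ []                 ≡⟨ ++-identityʳ x ⟩
      x                       ∎))
      where open ≡-Reasoning
    size-lt : size (subst (Derives G _) (sym eq′) (plug C t)) < _
    size-lt = begin-strict
      size (subst (Derives G _) (sym eq′) (plug C t)) ≡⟨ size-subst (sym eq′) (plug C t) ⟩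
      size (plug C t)                                   ≡⟨ size-plug C t ⟩
      ctxSize C + treeSize t                            <⟨ +-monoʳ-< (ctxSize C) (m<n+m (treeSize t) z<s) ⟩
      ctxSize C + (loopSize m + treeSize t)             ≡⟨ es ⟨
      _                                                 ∎
      where open ≤-Reasoning

  branching : ℕ
  branching = 2 + sum (map (length ∘ proj₂) rules)

  rhs-bound : ∀ {A β K} {u : Word} → (A , β) ∈ rules → length u ≤ length β * K → length u ≤ branching * K
  rhs-bound {β = β} {K} r le = ≤-trans le (*-monoˡ-≤ K (≤-trans (∈⇒≤sum (∈-map⁺ (length ∘ proj₂) r)) (m≤n+m _ 2)))

  -- largeSubtree descends to a subtree whose yield lies in (K, branching * K]. From there, repetition follows
  -- children whose yield exceeds branching ^ k, recording the nonterminals met in seen; the threshold can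
  -- drop only nN times, so some nonterminal repeats.
  data LargeSubtree (K : ℕ) (α : List Symbol) (w : Word) (s : ℕ) : Set where
    found : ∀ {B x} (t : Tree B x) → K < length x → length x ≤ branching * K →
            Occurrence B x (treeSize t) α w s → LargeSubtree K α w s
    short : length w ≤ length α * K → LargeSubtree K α w s

  largeSubtree : ∀ {K α w} → 1 ≤ K → (d : Derives G α w) → LargeSubtree K α w (size d)
  largeSubtree K≥1 nil = short z≤n
  largeSubtree K≥1 (term d) with largeSubtree K≥1 d
  ... | found t big bnd occ = found t big bnd (under-term occ)
  ... | short le            = short (+-mono-≤ K≥1 le)
  largeSubtree {K} K≥1 (nont {u = u} r d e) with K <? length u
  ... | yes big with largeSubtree K≥1 d
  ...   | found t big′ bnd occ = found t big′ bnd (under-head r e occ)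
  ...   | short le             = found (node r d) big (rhs-bound {u = u} r le) (at-head (size d) e)
  largeSubtree {K} K≥1 (nont {u = u} r d e) | no small with largeSubtree K≥1 e
  ... | found t big bnd occ = found t big bnd (under-tail r d occ)
  ... | short le            = short (≤-trans (≤-reflexive (length-++ u)) (+-mono-≤ (≮⇒≥ small) le))

  data Repetition (seen : List (Fin nN)) (K : ℕ) (α : List Symbol) (w : Word) (s : ℕ) : Set where
    pending  : ∀ {C x} → C ∈ seen → (t : Tree C x) → Occurrence C x (treeSize t) α w s → Repetition seen K α w s
    repeated : ∀ {B x} (m : Loop B) (t : Tree B x) →
               Occurrence B (loopˡ m ++ x ++ loopʳ m) (loopSize m + treeSize t) α w s → Repetition seen K α w s
    short    : length w ≤ length α * K → Repetition seen K α w s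

  branching^k≥1 : ∀ k → 1 ≤ branching ^ℕ k
  branching^k≥1 = m^n>0 branching

  mutual
    repetition : ∀ seen k → Unique seen → length seen + k ≡ nN → ∀ {α w} (d : Derives G α w) →
                 Repetition seen (branching ^ℕ k) α w (size d)
    repetition seen k _ _ nil = short z≤n
    repetition seen k uq eq (term d) with repetition seen k uq eq d
    ... | pending C∈ t occ = pending C∈ t (under-term occ)
    ... | repeated m t occ = repeated m t (under-term occ)
    ... | short le         = short (+-mono-≤ (branching^k≥1 k) le)
    repetition seen k uq eq (nont {A = A} {u = u} r d e) with branching ^ℕ k <? length u
    ... | yes big with A ∈? seen
    ...   | yes A∈ = pending A∈ (node r d) (at-head (size d) e)
    ...   | no A∉  = descend seen k uq eq r d e big A∉
    repetition seen k uq eq (nont {u = u} r d e) | no small with repetition seen k uq eq e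
    ... | pending C∈ t occ = pending C∈ t (under-tail r d occ)
    ... | repeated m t occ = repeated m t (under-tail r d occ)
    ... | short le         = short (≤-trans (≤-reflexive (length-++ u)) (+-mono-≤ (≮⇒≥ small) le))

    descend : ∀ seen k → Unique seen → length seen + k ≡ nN → ∀ {A β α u w}
              (r : (A , β) ∈ rules) (d : Derives G β u) (e : Derives G α w) →
              branching ^ℕ k < length u → A ∉ seen →
              Repetition seen (branching ^ℕ k) (inj₂ A ∷ α) (u ++ w) (size (nont r d e))
    descend seen zero uq eq r d e big A∉ =
      contradiction (Unique⇒length≤ (¬Any⇒All¬ seen A∉ ∷ uq)) (<⇒≱ (≤-reflexive (cong suc (sym (trans (sym (+-identityʳ _)) eq)))))
    descend seen (suc k) uq eq {A} {u = u} r d e big A∉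
      with repetition (A ∷ seen) k (¬Any⇒All¬ seen A∉ ∷ uq) (trans (sym (+-suc _ k)) eq) d
    ... | pending (here refl) t occ = repeated (loop r (Occurrence.ctx occ)) t (close-loop r e occ)
    ... | pending (there C∈) t occ  = pending C∈ t (under-head r e occ)
    ... | repeated m t occ          = repeated m t (under-head r e occ)
    ... | short le                  = contradiction (rhs-bound {u = u} r le) (<⇒≱ big)

  K₀ : ℕ
  K₀ = branching ^ℕ nN

  pumpingLength : ℕ
  pumpingLength = branching * K₀

  K₀<pumpingLength : K₀ < pumpingLength
  K₀<pumpingLength = subst (K₀ <_) (*-comm K₀ branching) (m<m*n K₀ branching {{>-nonZero (branching^k≥1 nN)}} (s≤s (s≤s z≤n)))

  loop-decomposition : ∀ {B x w s} (m : Loop B) (t : Tree B x) →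
                       Occurrence B (loopˡ m ++ x ++ loopʳ m) (loopSize m + treeSize t) (inj₂ start ∷ []) w s →
                       1 ≤ length (loopˡ m ++ loopʳ m) → length (loopˡ m ++ x ++ loopʳ m) ≤ pumpingLength →
                       PumpingDecomposition G pumpingLength w
  loop-decomposition {x = x} m t (occurrence C eq _) vy≢ε bound = record
    { u = yieldˡ C ; v = loopˡ m ; x = x ; y = loopʳ m ; z = yieldʳ C
    ; split = eq ; vy≢ε = vy≢ε ; |vxy|≤p = bound
    ; pump = λ i → plug C (iterate m t i) }

  mutual
    decompose : ∀ fuel {w} (d : Derives G (inj₂ start ∷ []) w) → size d ≤ fuel → K₀ < length w →
                PumpingDecomposition G pumpingLength w
    decompose fuel d d≤fuel K₀<w with largeSubtree (branching^k≥1 nN) d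
    ... | short le = contradiction (≤-trans le (≤-reflexive (+-identityʳ K₀))) (<⇒≱ K₀<w)
    ... | found {x = x₀} t₀@(node _ _) K₀<x₀ x₀≤p occ₀ with repetition [] nN [] refl (sentential t₀)
    ...   | pending () _ _
    ...   | short le = contradiction (≤-trans le (≤-reflexive (+-identityʳ K₀)))
                                     (<⇒≱ (subst (λ l → K₀ < length l) (sym (++-identityʳ x₀)) K₀<x₀))
    ...   | repeated m t occ₁@(occurrence D eq _) =
            shorten fuel d d≤fuel K₀<w m t (occurrence-trans occ₀ occ₁) bound
      where
      bound : length (loopˡ m ++ _ ++ loopʳ m) ≤ pumpingLength
      bound = ≤-trans (length-infix (yieldˡ D) _ (yieldʳ D))
                (≤-trans (≤-reflexive (cong length (trans (sym eq) (++-identityʳ x₀)))) x₀≤p)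

    -- A loop with empty yields is cut out and the search restarts on the smaller derivation: recursion on
    -- size replaces the usual choice of a derivation tree of minimal size.
    shorten : ∀ fuel {w B x} (d : Derives G (inj₂ start ∷ []) w) → size d ≤ fuel → K₀ < length w →
              (m : Loop B) (t : Tree B x) →
              Occurrence B (loopˡ m ++ x ++ loopʳ m) (loopSize m + treeSize t) (inj₂ start ∷ []) w (size d) →
              length (loopˡ m ++ x ++ loopʳ m) ≤ pumpingLength → PumpingDecomposition G pumpingLength w
    shorten fuel d d≤fuel K₀<w m t occ bound with loopˡ m ++ loopʳ m in vy
    ... | _ ∷ _ = loop-decomposition m t occ (subst (λ l → 1 ≤ length l) (sym vy) (s≤s z≤n)) bound
    ... | [] with cut-loop m t vy occ | fuel
    ...   | d′ , smaller | zero     = contradiction (≤-trans smaller d≤fuel) λ ()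
    ...   | d′ , smaller | suc fuel′ = decompose fuel′ d′ (≤-pred (≤-trans smaller d≤fuel)) K₀<w

pumping-lemma : (G : CFG) → Σ ℕ λ p → ∀ w → Lang G w → p ≤ length w → PumpingDecomposition G p w
pumping-lemma G = pumpingLength , λ w d p≤w → decompose (size d) d ≤-refl (<-≤-trans K₀<pumpingLength p≤w)
  where open Grammar G

-- Gap profiles of words over {a, b}

-- withB f gs l encodes the word a^f b a^g₁ b ⋯ b a^gⱼ b a^l, where gs = g₁ ⋯ gⱼ.
data Profile : Set where
  aOnly : ℕ → Profile
  withB : ℕ → List ℕ → ℕ → Profile

infixr 6 _·_

_·_ : Profile → Profile → Profile
aOnly m      · aOnly n        = aOnly (m + n)
aOnly m      · withB f gs l   = withB (m + f) gs l
withB f gs l · aOnly n        = withB f gs (l + n)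
withB f gs l · withB f′ gs′ l′ = withB f (gs ++ (l + f′) ∷ gs′) l′

·-assoc : ∀ S T U → (S · T) · U ≡ S · (T · U)
·-assoc (aOnly m)      (aOnly n)      (aOnly k)      = cong aOnly (+-assoc m n k)
·-assoc (aOnly m)      (aOnly n)      (withB f gs l) = cong (λ f′ → withB f′ gs l) (+-assoc m n f)
·-assoc (aOnly m)      (withB f gs l) (aOnly k)      = refl
·-assoc (aOnly m)      (withB f gs l) (withB _ _ _)  = refl
·-assoc (withB f gs l) (aOnly n)      (aOnly k)      = cong (withB f gs) (+-assoc l n k)
·-assoc (withB f gs l) (aOnly n)      (withB f′ gs′ l′) = cong (λ g → withB f (gs ++ g ∷ gs′) l′) (+-assoc l n f′)
·-assoc (withB f gs l) (withB _ _ _)  (aOnly k)      = refl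
·-assoc (withB f gs l) (withB f′ gs′ l′) (withB _ gs″ _) = cong (λ hs → withB f hs _) (++-assoc gs ((l + f′) ∷ gs′) _)

·-identityˡ : ∀ S → aOnly 0 · S ≡ S
·-identityˡ (aOnly n)      = refl
·-identityˡ (withB f gs l) = refl

profile : Word → Profile
profile []      = aOnly 0
profile (a ∷ w) = aOnly 1 · profile w
profile (b ∷ w) = withB 0 [] 0 · profile w

profile-++ : ∀ u v → profile (u ++ v) ≡ profile u · profile v
profile-++ []      v = sym (·-identityˡ (profile v))
profile-++ (a ∷ u) v = trans (cong (aOnly 1 ·_) (profile-++ u v)) (sym (·-assoc (aOnly 1) (profile u) (profile v)))
profile-++ (b ∷ u) v = trans (cong (withB 0 [] 0 ·_) (profile-++ u v)) (sym (·-assoc (withB 0 [] 0) (profile u) (profile v)))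

cyclicGaps : Profile → List ℕ
cyclicGaps (aOnly _)      = []
cyclicGaps (withB f gs l) = gs ∷ʳ (l + f)

cyclicGaps-·-comm : ∀ S T → cyclicGaps (S · T) ↭ cyclicGaps (T · S)
cyclicGaps-·-comm (aOnly m)      (aOnly n)      = ↭-refl
cyclicGaps-·-comm (aOnly m)      (withB f gs l) = ↭-reflexive (cong (λ g → gs ++ g ∷ []) (sym (+-assoc l m f)))
cyclicGaps-·-comm (withB f gs l) (aOnly n)      = ↭-reflexive (cong (λ g → gs ++ g ∷ []) (+-assoc l n f))
cyclicGaps-·-comm (withB f gs l) (withB f′ gs′ l′) = begin
  (gs ++ (l + f′) ∷ gs′) ++ (l′ + f) ∷ []         ≡⟨ ++-assoc-last gs _ gs′ ⟩
  (gs ++ (l + f′) ∷ []) ++ gs′ ++ (l′ + f) ∷ []   ↭⟨ ++-comm (gs ++ _ ∷ []) _ ⟩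
  (gs′ ++ (l′ + f) ∷ []) ++ gs ++ (l + f′) ∷ []   ≡⟨ ++-assoc-last gs′ _ gs ⟨
  (gs′ ++ (l′ + f) ∷ gs) ++ (l + f′) ∷ []         ∎
  where
  open PermutationReasoning
  ++-assoc-last : ∀ xs (g : ℕ) ys {zs} → (xs ++ g ∷ ys) ++ zs ≡ (xs ++ g ∷ []) ++ ys ++ zs
  ++-assoc-last xs g ys = trans (++-assoc xs (g ∷ ys) _) (sym (++-assoc xs (g ∷ []) _))

cyclicGaps-rotate : ∀ u v → cyclicGaps (profile (u ++ v)) ↭ cyclicGaps (profile (v ++ u))
cyclicGaps-rotate u v = begin
  cyclicGaps (profile (u ++ v))       ≡⟨ cong cyclicGaps (profile-++ u v) ⟩
  cyclicGaps (profile u · profile v)  ↭⟨ cyclicGaps-·-comm (profile u) (profile v) ⟩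
  cyclicGaps (profile v · profile u)  ≡⟨ cong cyclicGaps (profile-++ v u) ⟨
  cyclicGaps (profile (v ++ u))       ∎
  where open PermutationReasoning

_^ᵖ_ : Profile → ℕ → Profile
S ^ᵖ zero  = aOnly 0
S ^ᵖ suc k = S · S ^ᵖ k

profile-^ : ∀ v k → profile (v ^ k) ≡ profile v ^ᵖ k
profile-^ v zero    = refl
profile-^ v (suc k) = trans (profile-++ v (v ^ k)) (cong (profile v ·_) (profile-^ v k))

aOnly-^ᵖ : ∀ n k → aOnly n ^ᵖ k ≡ aOnly (k * n)
aOnly-^ᵖ n zero    = refl
aOnly-^ᵖ n (suc k) = cong (aOnly n ·_) (aOnly-^ᵖ n k)

withB-^ᵖ : ∀ f gs l k → withB f gs l ^ᵖ suc k ≡ withB f (gs ++ ((l + f) ∷ gs) ^* k) (l + 0)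
withB-^ᵖ f gs l zero    = cong (λ hs → withB f hs (l + 0)) (sym (++-identityʳ gs))
withB-^ᵖ f gs l (suc k) = cong (withB f gs l ·_) (withB-^ᵖ f gs l k)

cyclicGaps-^ᵖ : ∀ S k → cyclicGaps (S ^ᵖ k) ≡ cyclicGaps S ^* k
cyclicGaps-^ᵖ (aOnly n)      k       = trans (cong cyclicGaps (aOnly-^ᵖ n k)) (sym ([]-^* k))
cyclicGaps-^ᵖ (withB f gs l) zero    = refl
cyclicGaps-^ᵖ (withB f gs l) (suc k) = begin
  cyclicGaps (withB f gs l ^ᵖ suc k)             ≡⟨ cong cyclicGaps (withB-^ᵖ f gs l k) ⟩
  (gs ++ ((l + f) ∷ gs) ^* k) ++ (l + 0 + f) ∷ [] ≡⟨ cong (λ l′ → (gs ++ ((l + f) ∷ gs) ^* k) ++ (l′ + f) ∷ []) (+-identityʳ l) ⟩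
  (gs ++ ((l + f) ∷ gs) ^* k) ++ (l + f) ∷ []     ≡⟨ ^*-rotate (l + f) gs k ⟩
  (gs ++ (l + f) ∷ []) ^* suc k                   ∎
  where open ≡-Reasoning

cyclicGaps-^ : ∀ v k → cyclicGaps (profile (v ^ k)) ≡ cyclicGaps (profile v) ^* k
cyclicGaps-^ v k = trans (cong cyclicGaps (profile-^ v k)) (cyclicGaps-^ᵖ (profile v) k)

weight : Profile → ℕ
weight (aOnly n)      = n
weight (withB f gs l) = suc (f + sum gs + l + length gs)

weight-· : ∀ S T → weight (S · T) ≡ weight S + weight T
weight-· (aOnly m)      (aOnly n)      = refl
weight-· (aOnly m)      (withB f gs l) = shuffle m f (sum gs) l (length gs)
  where
  shuffle : ∀ m f s l j → suc (m + f + s + l + j) ≡ m + suc (f + s + l + j)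
  shuffle = solve-∀
weight-· (withB f gs l) (aOnly n)      = shuffle f (sum gs) l n (length gs)
  where
  shuffle : ∀ f s l n j → suc (f + s + (l + n) + j) ≡ suc (f + s + l + j) + n
  shuffle = solve-∀
weight-· (withB f gs l) (withB f′ gs′ l′) = begin
  suc (f + sum (gs ++ (l + f′) ∷ gs′) + l′ + length (gs ++ (l + f′) ∷ gs′))
    ≡⟨ cong₂ (λ s j → suc (f + s + l′ + j)) (sum-++ gs ((l + f′) ∷ gs′)) (length-++ gs) ⟩
  suc (f + (sum gs + (l + f′ + sum gs′)) + l′ + (length gs + suc (length gs′)))
    ≡⟨ shuffle f (sum gs) l f′ (sum gs′) l′ (length gs) (length gs′) ⟩
  suc (f + sum gs + l + length gs) + suc (f′ + sum gs′ + l′ + length gs′) ∎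
  where
  open ≡-Reasoning
  shuffle : ∀ f s l f′ s′ l′ j j′ → suc (f + (s + (l + f′ + s′)) + l′ + (j + suc j′)) ≡
                                    suc (f + s + l + j) + suc (f′ + s′ + l′ + j′)
  shuffle = solve-∀

weight-profile : ∀ w → weight (profile w) ≡ length w
weight-profile []      = refl
weight-profile (a ∷ w) = trans (weight-· (aOnly 1) (profile w)) (cong suc (weight-profile w))
weight-profile (b ∷ w) = trans (weight-· (withB 0 [] 0) (profile w)) (cong suc (weight-profile w))

-- Gap lists all of whose one-letter insertions are primitive

-- When pumping down deletes only a's from the witness, five gaps remain (FiveGaps); when it deletes a b,
-- two gaps merge into one long gap (FourGaps).
record FiveGaps (n t : ℕ) (L : List ℕ) : Set where
  field
    length≡5  : length L ≡ 5
    sum≤      : 2 + sum L ≤ 5 * suc n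
    all≥      : All (t ≤_) L
    all≤      : All (_≤ suc n) L
    some-full : 1 ≤ count (suc n ≤?_) L

record FourGaps (n : ℕ) (L : List ℕ) : Set where
  field
    length≡4      : length L ≡ 4
    sum<          : sum L < 5 * suc n
    one-long      : count (3 + n ≤?_) L ≡ 1
    long-or-short : All (λ g → 3 + n ≤ g ⊎ g ≤ suc n) L
    two-full      : 2 ≤ count (suc n ≤?_) L

Robust : ℕ → ℕ → List ℕ → Set
Robust n t L = FiveGaps n t L ⊎ FourGaps n L

Robust-↭ : ∀ {n t L L′} → L ↭ L′ → Robust n t L → Robust n t L′
Robust-↭ {n} p (inj₁ F) = inj₁ record
  { length≡5  = trans (sym (↭-length p)) length≡5
  ; sum≤      = subst (λ s → 2 + s ≤ _) (sum-↭ p) sum≤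
  ; all≥      = All-resp-↭ p all≥
  ; all≤      = All-resp-↭ p all≤
  ; some-full = subst (1 ≤_) (count-↭ (suc n ≤?_) p) some-full }
  where open FiveGaps F
Robust-↭ {n} p (inj₂ F) = inj₂ record
  { length≡4      = trans (sym (↭-length p)) length≡4
  ; sum<          = subst (_< _) (sum-↭ p) sum<
  ; one-long      = trans (sym (count-↭ (3 + n ≤?_) p)) one-long
  ; long-or-short = All-resp-↭ p long-or-short
  ; two-full      = subst (2 ≤_) (count-↭ (suc n ≤?_) p) two-full }
  where open FourGaps F

module _ {n : ℕ} (xs : List ℕ) (k : ℕ) (2≤k : 2 ≤ k) where

  five-bump : ∀ {t gs g} → FiveGaps n t (gs ∷ʳ g) → gs ∷ʳ suc g ≢ xs ^* k
  five-bump {gs = gs} {g} F eq = <⇒≱ sum< (power-of-length-5 (suc n) xs k eq 2≤k length≡5′ some-full′)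
    where
    open FiveGaps F
    length≡5′ : length (gs ∷ʳ suc g) ≡ 5
    length≡5′ = trans (length-∷ʳ gs _) (trans (sym (length-∷ʳ gs g)) length≡5)
    some-full′ : 1 ≤ count (suc n ≤?_) (gs ∷ʳ suc g)
    some-full′ = ≤-trans some-full (count≤?-mono-∷ʳ (suc n) gs (n≤1+n g))
    sum< : sum (gs ∷ʳ suc g) < 5 * suc n
    sum< = begin-strict
      sum (gs ∷ʳ suc g)   ≡⟨ sum-∷ʳ gs (suc g) ⟩
      sum gs + suc g      ≡⟨ +-suc (sum gs) g ⟩
      suc (sum gs + g)    ≡⟨ cong suc (sum-∷ʳ gs g) ⟨
      suc (sum (gs ∷ʳ g)) <⟨ sum≤ ⟩
      5 * suc n           ∎
      where open ≤-Reasoning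

  four-bump : ∀ {gs g} → FourGaps n (gs ∷ʳ g) → gs ∷ʳ suc g ≢ xs ^* k
  four-bump {gs} {g} F eq = count-^*-≢-1 (3 + n ≤?_) xs k eq 2≤k (begin
    count (3 + n ≤?_) (gs ∷ʳ suc g)                       ≡⟨ count-++ (3 + n ≤?_) gs _ ⟩
    count (3 + n ≤?_) gs + count (3 + n ≤?_) (suc g ∷ []) ≡⟨ cong (count (3 + n ≤?_) gs +_) last-unchanged ⟩
    count (3 + n ≤?_) gs + count (3 + n ≤?_) (g ∷ [])     ≡⟨ count-++ (3 + n ≤?_) gs _ ⟨
    count (3 + n ≤?_) (gs ∷ʳ g)                           ≡⟨ one-long ⟩
    1                                                     ∎)
    where
    open FourGaps F
    open ≡-Reasoning
    last-unchanged : count (3 + n ≤?_) (suc g ∷ []) ≡ count (3 + n ≤?_) (g ∷ [])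
    last-unchanged with proj₂ (∷ʳ⁻ long-or-short)
    ... | inj₁ long  = trans (count-accept (3 + n ≤?_) (m≤n⇒m≤1+n long)) (sym (count-accept (3 + n ≤?_) long))
    ... | inj₂ short = trans (count-reject (3 + n ≤?_) (<⇒≱ (s≤s (s≤s short))))
                             (sym (count-reject (3 + n ≤?_) (<⇒≱ (s≤s (m≤n⇒m≤1+n short)))))

  four-split : ∀ {gs l f} → FourGaps n (gs ∷ʳ (l + f)) → (gs ∷ʳ l) ∷ʳ f ≢ xs ^* k
  four-split {gs} {l} {f} F eq = <⇒≱ split-sum< (power-of-length-5 (suc n) xs k eq 2≤k length≡5 some-full)
    where
    open FourGaps F
    length≡5 : length ((gs ∷ʳ l) ∷ʳ f) ≡ 5
    length≡5 = trans (length-∷ʳ (gs ∷ʳ l) f) (cong suc (trans (length-∷ʳ gs l) (trans (sym (length-∷ʳ gs _)) length≡4)))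
    some-full : 1 ≤ count (suc n ≤?_) ((gs ∷ʳ l) ∷ʳ f)
    some-full = ≤-trans (≤-pred (≤-trans two-full (count-∷ʳ-≤-suc (suc n ≤?_) gs (l + f))))
                  (≤-trans (count-∷ʳ-≤ (suc n ≤?_) gs l) (count-∷ʳ-≤ (suc n ≤?_) (gs ∷ʳ l) f))
    split-sum< : sum ((gs ∷ʳ l) ∷ʳ f) < 5 * suc n
    split-sum< = begin-strict
      sum ((gs ∷ʳ l) ∷ʳ f) ≡⟨ sum-∷ʳ (gs ∷ʳ l) f ⟩
      sum (gs ∷ʳ l) + f    ≡⟨ cong (_+ f) (sum-∷ʳ gs l) ⟩
      sum gs + l + f       ≡⟨ +-assoc (sum gs) l f ⟩
      sum gs + (l + f)     ≡⟨ sum-∷ʳ gs (l + f) ⟨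
      sum (gs ∷ʳ (l + f))  <⟨ sum< ⟩
      5 * suc n            ∎
      where open ≤-Reasoning

  -- Splitting a gap of size at most n+1 leaves at least one part below t, while all other gaps are at
  -- least t: so exactly one cyclically adjacent pair of gaps rises across t.
  five-split : ∀ {t gs l f} → suc n < t + t → FiveGaps n t (gs ∷ʳ (l + f)) → (gs ∷ʳ l) ∷ʳ f ≢ xs ^* k
  five-split {gs = []} _ F _ with () ← FiveGaps.length≡5 F
  five-split {t} {g₀ ∷ gs′} {l} {f} n+1<2t F eq
    with all≥′@(t≤g₀ ∷ _) , _ ← ∷ʳ⁻ {xs = g₀ ∷ gs′} (FiveGaps.all≥ F)
       | _ , l+f≤n+1          ← ∷ʳ⁻ {xs = g₀ ∷ gs′} (FiveGaps.all≤ F) =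
    cyclicPairs-count-^*-≢-1 (ascent? t) xs k eq 2≤k (begin
      count (ascent? t) (cyclicPairs (((g₀ ∷ gs′) ∷ʳ l) ∷ʳ f))           ≡⟨ cong (count (ascent? t) ∘ pairsTo g₀) (++-assoc (g₀ ∷ gs′) (l ∷ []) (f ∷ [])) ⟩
      count (ascent? t) (pairsTo g₀ ((g₀ ∷ gs′) ++ l ∷ f ∷ []))          ≡⟨ cong (count (ascent? t)) (pairsTo-++ g₀ g₀ gs′ l (f ∷ [])) ⟩
      count (ascent? t) (pairsTo l (g₀ ∷ gs′) ++ (l , f) ∷ (f , g₀) ∷ []) ≡⟨ count-++ (ascent? t) (pairsTo l (g₀ ∷ gs′)) _ ⟩
      count (ascent? t) (pairsTo l (g₀ ∷ gs′)) + count (ascent? t) ((l , f) ∷ (f , g₀) ∷ [])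
        ≡⟨ cong₂ _+_ (ascents-from-high t l (g₀ ∷ gs′) all≥′) (ascents-of-split t l f g₀ t≤g₀ some-part-small) ⟩
      1                                                                  ∎)
    where
    open ≡-Reasoning
    some-part-small : l < t ⊎ f < t
    some-part-small with l <? t | f <? t
    ... | yes l<t | _       = inj₁ l<t
    ... | no _    | yes f<t = inj₂ f<t
    ... | no l≮t  | no f≮t = contradiction (≤-trans (+-mono-≤ (≮⇒≥ l≮t) (≮⇒≥ f≮t)) l+f≤n+1) (<⇒≱ n+1<2t)

cyclicGaps-append-a : ∀ R {f gs l} → profile R ≡ withB f gs l → cyclicGaps (profile (R ∷ʳ a)) ≡ gs ∷ʳ suc (l + f)
cyclicGaps-append-a R {f} {gs} {l} pR = begin
  cyclicGaps (profile (R ∷ʳ a))          ≡⟨ cong cyclicGaps (profile-++ R (a ∷ [])) ⟩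
  cyclicGaps (profile R · aOnly 1)       ≡⟨ cong (λ S → cyclicGaps (S · aOnly 1)) pR ⟩
  gs ∷ʳ (l + 1 + f)                      ≡⟨ cong (λ l′ → gs ∷ʳ (l′ + f)) (+-comm l 1) ⟩
  gs ∷ʳ suc (l + f)                      ∎
  where open ≡-Reasoning

cyclicGaps-append-b : ∀ R {f gs l} → profile R ≡ withB f gs l → cyclicGaps (profile (R ∷ʳ b)) ≡ (gs ∷ʳ l) ∷ʳ f
cyclicGaps-append-b R {f} {gs} {l} pR = begin
  cyclicGaps (profile (R ∷ʳ b))          ≡⟨ cong cyclicGaps (profile-++ R (b ∷ [])) ⟩
  cyclicGaps (profile R · withB 0 [] 0)  ≡⟨ cong (λ S → cyclicGaps (S · withB 0 [] 0)) pR ⟩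
  (gs ∷ʳ (l + 0)) ∷ʳ f                   ≡⟨ cong (λ l′ → (gs ∷ʳ l′) ∷ʳ f) (+-identityʳ l) ⟩
  (gs ∷ʳ l) ∷ʳ f                         ∎
  where open ≡-Reasoning

module _ {n t : ℕ} (n+1<2t : suc n < t + t) where

  append-not-power : ∀ R c v k → Robust n t (cyclicGaps (profile R)) → 2 ≤ k → R ∷ʳ c ≢ v ^ k
  append-not-power R c v k robust 2≤k eq with profile R in pR
  ... | aOnly _ = [ (λ F → contradiction (FiveGaps.length≡5 F) λ ()) , (λ F → contradiction (FourGaps.length≡4 F) λ ()) ]′ robust
  ... | withB f gs l = by-letter c eq
    where
    power : ∀ {c} → R ∷ʳ c ≡ v ^ k → cyclicGaps (profile (R ∷ʳ c)) ≡ cyclicGaps (profile v) ^* k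
    power eq = trans (cong (cyclicGaps ∘ profile) eq) (cyclicGaps-^ v k)
    by-letter : ∀ c → R ∷ʳ c ≢ v ^ k
    by-letter a eq = [ (λ F → five-bump _ k 2≤k F gaps) , (λ F → four-bump _ k 2≤k F gaps) ]′ robust
      where
      gaps : gs ∷ʳ suc (l + f) ≡ cyclicGaps (profile v) ^* k
      gaps = trans (sym (cyclicGaps-append-a R pR)) (power eq)
    by-letter b eq = [ (λ F → five-split _ k 2≤k n+1<2t F gaps) , (λ F → four-split _ k 2≤k F gaps) ]′ robust
      where
      gaps : (gs ∷ʳ l) ∷ʳ f ≡ cyclicGaps (profile v) ^* k
      gaps = trans (sym (cyclicGaps-append-b R pR)) (power eq)

  insertion-primitive : ∀ W → Robust n t (cyclicGaps (profile W)) → ∀ i c → Primitive (insertAt i c W)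
  insertion-primitive W robust i c = nonempty , not-power
    where
    p q : Word
    p = take i W
    q = drop i W
    nonempty : insertAt i c W ≢ []
    nonempty eq with () ← ++-conicalʳ p _ eq
    robust′ : Robust n t (cyclicGaps (profile (q ++ p)))
    robust′ = Robust-↭ (↭-trans (↭-reflexive (cong (cyclicGaps ∘ profile) (sym (take++drop≡id i W))))
                                (cyclicGaps-rotate p q)) robust
    not-power : ¬ Σ Word λ v → Σ ℕ λ k → (2 ≤ k) × (insertAt i c W ≡ v ^ k)
    not-power (v , k , 2≤k , eq) with v′ , eq′ ← ^*-conjugate (p ∷ʳ c) q v k (trans (++-assoc p (c ∷ []) q) eq) =
      append-not-power (q ++ p) c v′ k robust′ 2≤k (trans (++-assoc q p (c ∷ [])) eq′)

-- Deleting a short window from the witness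

Near : ℕ → ℕ → Set
Near n g = n ≤ g × g ≤ suc n

record BaseGaps (n : ℕ) (L : List ℕ) : Set where
  field
    length≡5  : length L ≡ 5
    sum≡      : suc (sum L) ≡ 5 * suc n
    bounds    : All (Near n) L
    four-full : count (suc n ≤?_) L ≡ 4

BaseGaps-↭ : ∀ {n L L′} → L ↭ L′ → BaseGaps n L → BaseGaps n L′
BaseGaps-↭ {n} p B = record
  { length≡5  = trans (sym (↭-length p)) length≡5
  ; sum≡      = trans (cong suc (sym (sum-↭ p))) sum≡
  ; bounds    = All-resp-↭ p bounds
  ; four-full = trans (sym (count-↭ (suc n ≤?_) p)) four-full }
  where open BaseGaps B

module Deletion {n p t : ℕ} (p+3≤n : p + 3 ≤ n) (t+p≤n : t + p ≤ n) where

  private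
    t≤n : t ≤ n
    t≤n = ≤-trans (m≤m+n t p) t+p≤n

    p<n : p < n
    p<n = ≤-trans (≤-reflexive (+-comm 1 p)) (≤-trans (+-monoʳ-≤ p (s≤s z≤n)) p+3≤n)

    above-t : ∀ {g d g′} → n ≤ g′ → g + d ≡ g′ → d ≤ p → t ≤ g
    above-t {g} {d} n≤g′ eq d≤p = +-cancelʳ-≤ p t g (begin
      t + p  ≤⟨ t+p≤n ⟩
      n      ≤⟨ n≤g′ ⟩
      _      ≡⟨ eq ⟨
      g + d  ≤⟨ +-monoʳ-≤ g d≤p ⟩
      g + p  ∎)
      where open ≤-Reasoning

    below-n+1 : ∀ {g d g′} → g′ ≤ suc n → g + d ≡ g′ → g ≤ suc n
    below-n+1 {g} {d} g′≤ eq = ≤-trans (m≤m+n g d) (subst (_≤ suc n) (sym eq) g′≤)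

    full-in-init : ∀ gs g c → suc c ≤ count (suc n ≤?_) (gs ∷ʳ g) → c ≤ count (suc n ≤?_) gs
    full-in-init gs g c le = ≤-pred (≤-trans le (count-∷ʳ-≤-suc (suc n ≤?_) gs g))

  shorten-last : ∀ {gs g d g′} → BaseGaps n (gs ∷ʳ g′) → g + d ≡ g′ → 1 ≤ d → d ≤ p → FiveGaps n t (gs ∷ʳ g)
  shorten-last {gs} {g} {d} {g′} B eq 1≤d d≤p = record
    { length≡5  = trans (length-∷ʳ gs g) (trans (sym (length-∷ʳ gs g′)) length≡5)
    ; sum≤      = begin
        2 + sum (gs ∷ʳ g)    ≡⟨ cong (2 +_) (sum-∷ʳ gs g) ⟩
        suc (1 + (sum gs + g)) ≡⟨ cong suc (+-comm 1 _) ⟩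
        suc (sum gs + g + 1) ≤⟨ s≤s (+-monoʳ-≤ (sum gs + g) 1≤d) ⟩
        suc (sum gs + g + d) ≡⟨ cong suc (trans (+-assoc (sum gs) g d) (cong (sum gs +_) eq)) ⟩
        suc (sum gs + g′)    ≡⟨ cong suc (sum-∷ʳ gs g′) ⟨
        suc (sum (gs ∷ʳ g′)) ≡⟨ sum≡ ⟩
        5 * suc n            ∎
    ; all≥      = ∷ʳ⁺ (All.map (≤-trans t≤n ∘ proj₁) init) (above-t (proj₁ last) eq d≤p)
    ; all≤      = ∷ʳ⁺ (All.map proj₂ init) (below-n+1 (proj₂ last) eq)
    ; some-full = ≤-trans (≤-trans (s≤s z≤n) (full-in-init gs g′ 3 (≤-reflexive (sym four-full)))) (count-∷ʳ-≤ (suc n ≤?_) gs g) }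
    where
    open BaseGaps B
    open ≤-Reasoning
    init : All (Near n) gs
    init = proj₁ (∷ʳ⁻ bounds)
    last : Near n g′
    last = proj₂ (∷ʳ⁻ bounds)

  shorten-last-two : ∀ {gs g₁ d₁ g₁′ g₂ d₂ g₂′} → BaseGaps n ((gs ∷ʳ g₁′) ∷ʳ g₂′) → g₁ + d₁ ≡ g₁′ → g₂ + d₂ ≡ g₂′ →
                     1 ≤ d₁ + d₂ → d₁ + d₂ ≤ p → FiveGaps n t ((gs ∷ʳ g₁) ∷ʳ g₂)
  shorten-last-two {gs} {g₁} {d₁} {g₁′} {g₂} {d₂} {g₂′} B eq₁ eq₂ 1≤d d≤p = record
    { length≡5  = trans (length-∷ʳ-∷ʳ gs g₁ g₂) (trans (sym (length-∷ʳ-∷ʳ gs g₁′ g₂′)) length≡5)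
    ; sum≤      = begin
        2 + sum ((gs ∷ʳ g₁) ∷ʳ g₂)             ≡⟨ cong (2 +_) (sum-∷ʳ-∷ʳ gs g₁ g₂) ⟩
        suc (1 + (sum gs + g₁ + g₂))           ≡⟨ cong suc (+-comm 1 _) ⟩
        suc (sum gs + g₁ + g₂ + 1)             ≤⟨ s≤s (+-monoʳ-≤ (sum gs + g₁ + g₂) 1≤d) ⟩
        suc (sum gs + g₁ + g₂ + (d₁ + d₂))     ≡⟨ cong suc (shuffle (sum gs) g₁ g₂ d₁ d₂) ⟩
        suc (sum gs + (g₁ + d₁) + (g₂ + d₂))   ≡⟨ cong₂ (λ x y → suc (sum gs + x + y)) eq₁ eq₂ ⟩
        suc (sum gs + g₁′ + g₂′)               ≡⟨ cong suc (sum-∷ʳ-∷ʳ gs g₁′ g₂′) ⟨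
        suc (sum ((gs ∷ʳ g₁′) ∷ʳ g₂′))         ≡⟨ sum≡ ⟩
        5 * suc n                              ∎
    ; all≥      = ∷ʳ⁺ (∷ʳ⁺ (All.map (≤-trans t≤n ∘ proj₁) init)
                           (above-t (proj₁ last₁) eq₁ (≤-trans (m≤m+n d₁ d₂) d≤p)))
                      (above-t (proj₁ last₂) eq₂ (≤-trans (m≤n+m d₂ d₁) d≤p))
    ; all≤      = ∷ʳ⁺ (∷ʳ⁺ (All.map proj₂ init) (below-n+1 (proj₂ last₁) eq₁)) (below-n+1 (proj₂ last₂) eq₂)
    ; some-full = ≤-trans (≤-trans (s≤s z≤n) (full-in-init gs g₁′ 2 (full-in-init (gs ∷ʳ g₁′) g₂′ 3 (≤-reflexive (sym four-full)))))
                    (≤-trans (count-∷ʳ-≤ (suc n ≤?_) gs g₁) (count-∷ʳ-≤ (suc n ≤?_) (gs ∷ʳ g₁) g₂)) }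
    where
    open BaseGaps B
    open ≤-Reasoning
    shuffle : ∀ s x y d e → s + x + y + (d + e) ≡ s + (x + d) + (y + e)
    shuffle = solve-∀
    init : All (Near n) gs
    init  = proj₁ (∷ʳ⁻ (proj₁ (∷ʳ⁻ bounds)))
    last₁ : Near n g₁′
    last₁ = proj₂ (∷ʳ⁻ (proj₁ (∷ʳ⁻ bounds)))
    last₂ : Near n g₂′
    last₂ = proj₂ (∷ʳ⁻ bounds)

  merge-last-two : ∀ {gs g₁ g₂ g r} → BaseGaps n ((gs ∷ʳ g₁) ∷ʳ g₂) → g + r ≡ g₁ + g₂ → r ≤ p → FourGaps n (gs ∷ʳ g)
  merge-last-two {gs} {g₁} {g₂} {g} {r} B eq r≤p = record
    { length≡4      = trans (length-∷ʳ gs g) (suc-injective (trans (sym (length-∷ʳ-∷ʳ gs g₁ g₂)) length≡5))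
    ; sum<          = begin-strict
        sum (gs ∷ʳ g)                ≡⟨ sum-∷ʳ gs g ⟩
        sum gs + g                   ≤⟨ +-monoʳ-≤ (sum gs) (≤-trans (m≤m+n g r) (≤-reflexive eq)) ⟩
        sum gs + (g₁ + g₂)           ≡⟨ +-assoc (sum gs) g₁ g₂ ⟨
        sum gs + g₁ + g₂             ≡⟨ sum-∷ʳ-∷ʳ gs g₁ g₂ ⟨
        sum ((gs ∷ʳ g₁) ∷ʳ g₂)       <⟨ ≤-reflexive sum≡ ⟩
        5 * suc n                    ∎
    ; one-long      = trans (count-++ (3 + n ≤?_) gs (g ∷ []))
                        (cong₂ _+_ (cong length (filter-none (3 + n ≤?_) (All.map (λ (_ , g≤) → <⇒≱ (s≤s (m≤n⇒m≤1+n g≤))) init)))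
                                   (count-accept (3 + n ≤?_) long))
    ; long-or-short = ∷ʳ⁺ (All.map (inj₂ ∘ proj₂) init) (inj₁ long)
    ; two-full      = ≤-trans (full-in-init gs g₁ 2 (full-in-init (gs ∷ʳ g₁) g₂ 3 (≤-reflexive (sym four-full))))
                        (count-∷ʳ-≤ (suc n ≤?_) gs g) }
    where
    open BaseGaps B
    open ≤-Reasoning
    init : All (Near n) gs
    init = proj₁ (∷ʳ⁻ (proj₁ (∷ʳ⁻ bounds)))
    last₁ : Near n g₁
    last₁ = proj₂ (∷ʳ⁻ (proj₁ (∷ʳ⁻ bounds)))
    last₂ : Near n g₂
    last₂ = proj₂ (∷ʳ⁻ bounds)
    long : 3 + n ≤ g
    long = +-cancelʳ-≤ r (3 + n) g (begin
      3 + n + r                         ≤⟨ +-monoʳ-≤ (3 + n) r≤p ⟩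
      3 + n + p                         ≡⟨ +-comm (3 + n) p ⟩
      p + (3 + n)                       ≡⟨ +-assoc p 3 n ⟨
      p + 3 + n                         ≤⟨ +-monoˡ-≤ n p+3≤n ⟩
      n + n                             ≤⟨ +-mono-≤ (proj₁ last₁) (proj₁ last₂) ⟩
      g₁ + g₂                           ≡⟨ eq ⟨
      g + r                             ∎)

  private
    sum≤weight : ∀ f gs l → sum gs ≤ weight (withB f gs l)
    sum≤weight f gs l = ≤-trans (m≤n+m (sum gs) f) (≤-trans (m≤m+n _ l) (≤-trans (m≤m+n _ (length gs)) (n≤1+n _)))

    interior-gaps : ∀ {P : ℕ → Set} Q f gs l → All P (cyclicGaps (Q · withB f gs l)) → All P gs
    interior-gaps (aOnly m)         f gs l al = proj₁ (∷ʳ⁻ al)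
    interior-gaps (withB fQ gsQ lQ) f gs l al with _ ∷ al′ ← ++⁻ʳ gsQ (proj₁ (∷ʳ⁻ {xs = gsQ ++ _ ∷ gs} al)) = al′

  -- Every gap of the base word exceeds p, so a factor of weight at most p contains at most one b.
  at-most-one-b : ∀ Q {f gs l} → BaseGaps n (cyclicGaps (Q · withB f gs l)) → weight (withB f gs l) ≤ p → gs ≡ []
  at-most-one-b Q {gs = []}         _ _   = refl
  at-most-one-b Q {f} {g ∷ gs} {l} B w≤p with (n≤g , _) ∷ _ ← interior-gaps Q f (g ∷ gs) l (BaseGaps.bounds B) =
    contradiction (≤-trans n≤g (≤-trans (m≤m+n g (sum gs)) (≤-trans (sum≤weight f (g ∷ gs) l) w≤p)))
                  (<⇒≱ p<n)

  private
    weight-·· : ∀ V X Y → weight V + (weight X + weight Y) ≤ p → weight (V · X · Y) ≤ p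
    weight-·· V X Y = subst (_≤ p) (sym (trans (weight-· V (X · Y)) (cong (weight V +_) (weight-· X Y))))

    too-few-gaps : ∀ m S → BaseGaps n (cyclicGaps (aOnly m · S)) → weight S ≤ p → ⊥
    too-few-gaps m (aOnly k)      B _   with () ← BaseGaps.length≡5 B
    too-few-gaps m (withB f gs l) B w≤p with refl ← at-most-one-b (aOnly m) {f} {gs} {l} B w≤p | () ← BaseGaps.length≡5 B

  -- Q · V · X · Y is the profile of the rotated witness z u v x y; by at-most-one-b the window v x y holds at
  -- most one b, and the cases below are whether it lies in v, in x, in y, or nowhere.
  delete-window : ∀ Q V X Y → BaseGaps n (cyclicGaps (Q · V · X · Y)) → weight V + (weight X + weight Y) ≤ p →
                  1 ≤ weight V + weight Y → Robust n t (cyclicGaps (Q · X))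
  delete-window (aOnly m) V X Y B w≤p _ = ⊥-elim (too-few-gaps m (V · X · Y) B (weight-·· V X Y w≤p))
  delete-window (withB fQ gsQ lQ) (aOnly pv) (aOnly px) (aOnly py) B w≤p 1≤vy =
    inj₁ (shorten-last B (shuffle lQ px fQ pv py) 1≤vy (≤-trans (+-monoʳ-≤ pv (m≤n+m py px)) w≤p))
    where
    shuffle : ∀ lQ px fQ pv py → lQ + px + fQ + (pv + py) ≡ lQ + (pv + (px + py)) + fQ
    shuffle = solve-∀
  delete-window (withB fQ gsQ lQ) V@(withB f₁ gs₁ l₁) X@(aOnly px) Y@(aOnly py) B w≤p _
    with refl ← at-most-one-b (withB fQ gsQ lQ) B (weight-·· V X Y w≤p) =
    inj₂ (merge-last-two B (shuffle lQ px fQ f₁ l₁ py) (≤-trans (r≤ f₁ l₁ px py) w≤p))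
    where
    shuffle : ∀ lQ px fQ f₁ l₁ py → lQ + px + fQ + (f₁ + l₁ + py) ≡ lQ + f₁ + (l₁ + (px + py) + fQ)
    shuffle = solve-∀
    r≤ : ∀ f₁ l₁ px py → f₁ + l₁ + py ≤ suc (f₁ + 0 + l₁ + 0) + (px + py)
    r≤ f₁ l₁ px py = ≤-trans (m≤n+m _ (suc px)) (≤-reflexive (shuffle′ f₁ l₁ px py))
      where
      shuffle′ : ∀ f₁ l₁ px py → suc px + (f₁ + l₁ + py) ≡ suc (f₁ + 0 + l₁ + 0) + (px + py)
      shuffle′ = solve-∀
  delete-window (withB fQ gsQ lQ) V@(aOnly pv) X@(withB f₁ gs₁ l₁) Y@(aOnly py) B w≤p 1≤vy
    with refl ← at-most-one-b (withB fQ gsQ lQ) B (weight-·· V X Y w≤p) =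
    inj₁ (shorten-last-two B (shuffle₁ lQ f₁ pv) (+-comm-last l₁ fQ py) 1≤vy (≤-trans (+-monoʳ-≤ pv (m≤n+m py _)) w≤p))
    where
    shuffle₁ : ∀ lQ f₁ pv → lQ + f₁ + pv ≡ lQ + (pv + f₁)
    shuffle₁ = solve-∀
    +-comm-last : ∀ l₁ fQ py → l₁ + fQ + py ≡ l₁ + py + fQ
    +-comm-last = solve-∀
  delete-window (withB fQ gsQ lQ) V@(aOnly pv) X@(aOnly px) Y@(withB f₁ gs₁ l₁) B w≤p _
    with refl ← at-most-one-b (withB fQ gsQ lQ) B (weight-·· V X Y w≤p) =
    inj₂ (merge-last-two B (shuffle lQ px fQ pv f₁ l₁) (≤-trans (r≤ pv f₁ l₁ px) w≤p))
    where
    shuffle : ∀ lQ px fQ pv f₁ l₁ → lQ + px + fQ + (pv + f₁ + l₁) ≡ lQ + (pv + (px + f₁)) + (l₁ + fQ)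
    shuffle = solve-∀
    r≤ : ∀ pv f₁ l₁ px → pv + f₁ + l₁ ≤ pv + (px + suc (f₁ + 0 + l₁ + 0))
    r≤ pv f₁ l₁ px = ≤-trans (m≤n+m _ (suc px)) (≤-reflexive (shuffle′ pv f₁ l₁ px))
      where
      shuffle′ : ∀ pv f₁ l₁ px → suc px + (pv + f₁ + l₁) ≡ pv + (px + suc (f₁ + 0 + l₁ + 0))
      shuffle′ = solve-∀
  delete-window Q@(withB _ _ _) V@(withB _ gs₁ _) X@(withB _ _ _) Y@(aOnly _) B w≤p _
    with () ← ++-conicalʳ gs₁ _ (at-most-one-b Q B (weight-·· V X Y w≤p))
  delete-window Q@(withB _ _ _) V@(withB _ gs₁ _) X@(withB _ _ _) Y@(withB _ _ _) B w≤p _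
    with () ← ++-conicalʳ gs₁ _ (at-most-one-b Q B (weight-·· V X Y w≤p))
  delete-window Q@(withB _ _ _) V@(withB _ gs₁ _) X@(aOnly _) Y@(withB _ _ _) B w≤p _
    with () ← ++-conicalʳ gs₁ _ (at-most-one-b Q B (weight-·· V X Y w≤p))
  delete-window Q@(withB _ _ _) V@(aOnly _) X@(withB _ gs₂ _) Y@(withB _ _ _) B w≤p _
    with () ← ++-conicalʳ gs₂ _ (at-most-one-b Q B (weight-·· V X Y w≤p))

  deletion-robust : ∀ u v x y z → BaseGaps n (cyclicGaps (profile (u ++ (v ++ x ++ y) ++ z))) →
                    length (v ++ x ++ y) ≤ p → 1 ≤ length (v ++ y) → Robust n t (cyclicGaps (profile (u ++ x ++ z)))
  deletion-robust u v x y z B |vxy|≤p 1≤|vy| =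
    Robust-↭ rotate-back (delete-window (profile (z ++ u)) (profile v) (profile x) (profile y) B′ w≤p 1≤w)
    where
    open PermutationReasoning
    B′ : BaseGaps n (cyclicGaps (profile (z ++ u) · profile v · profile x · profile y))
    B′ = BaseGaps-↭ (begin
      cyclicGaps (profile (u ++ (v ++ x ++ y) ++ z))   ≡⟨ cong (cyclicGaps ∘ profile) (++-assoc u _ z) ⟨
      cyclicGaps (profile ((u ++ v ++ x ++ y) ++ z))   ↭⟨ cyclicGaps-rotate (u ++ v ++ x ++ y) z ⟩
      cyclicGaps (profile (z ++ u ++ v ++ x ++ y))     ≡⟨ cong (cyclicGaps ∘ profile) (++-assoc z u _) ⟨
      cyclicGaps (profile ((z ++ u) ++ v ++ x ++ y))   ≡⟨ cong cyclicGaps (profile-++ (z ++ u) _) ⟩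
      cyclicGaps (profile (z ++ u) · profile (v ++ x ++ y)) ≡⟨ cong (λ S → cyclicGaps (profile (z ++ u) · S))
                                                                   (trans (profile-++ v _) (cong (profile v ·_) (profile-++ x y))) ⟩
      cyclicGaps (profile (z ++ u) · profile v · profile x · profile y) ∎) B
    rotate-back : cyclicGaps (profile (z ++ u) · profile x) ↭ cyclicGaps (profile (u ++ x ++ z))
    rotate-back = begin
      cyclicGaps (profile (z ++ u) · profile x) ≡⟨ cong cyclicGaps (profile-++ (z ++ u) x) ⟨
      cyclicGaps (profile ((z ++ u) ++ x))      ≡⟨ cong (cyclicGaps ∘ profile) (++-assoc z u x) ⟩
      cyclicGaps (profile (z ++ u ++ x))        ↭⟨ cyclicGaps-rotate z (u ++ x) ⟩
      cyclicGaps (profile ((u ++ x) ++ z))      ≡⟨ cong (cyclicGaps ∘ profile) (++-assoc u x z) ⟩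
      cyclicGaps (profile (u ++ x ++ z))        ∎
    w≤p : weight (profile v) + (weight (profile x) + weight (profile y)) ≤ p
    w≤p = subst (_≤ p) (trans (length-++ v) (cong₂ _+_ (sym (weight-profile v))
                         (trans (length-++ x) (cong₂ _+_ (sym (weight-profile x)) (sym (weight-profile y)))))) |vxy|≤p
    1≤w : 1 ≤ weight (profile v) + weight (profile y)
    1≤w = subst (1 ≤_) (trans (length-++ v) (cong₂ _+_ (sym (weight-profile v)) (sym (weight-profile y)))) 1≤|vy|

-- The witness

block : ℕ → Word
block n = replicate (suc n) a ∷ʳ b

witness : ℕ → Word
witness n = replicate n a ++ b ∷ block n ^ 4

profile-aⁿ : ∀ k → profile (replicate k a) ≡ aOnly k
profile-aⁿ zero    = refl
profile-aⁿ (suc k) = cong (aOnly 1 ·_) (profile-aⁿ k)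

cyclicGaps-witness : ∀ n → cyclicGaps (profile (witness n)) ≡ suc n ∷ suc n ∷ suc n ∷ suc n ∷ n ∷ []
cyclicGaps-witness n = begin
  cyclicGaps (profile (witness n))
    ≡⟨ cong cyclicGaps (profile-++ (replicate n a) (b ∷ block n ^ 4)) ⟩
  cyclicGaps (profile (replicate n a) · withB 0 [] 0 · profile (block n ^ 4))
    ≡⟨ cong₂ (λ S T → cyclicGaps (S · withB 0 [] 0 · T)) (profile-aⁿ n) (trans (profile-^ (block n) 4) (cong (_^ᵖ 4) profile-block)) ⟩
  suc n ∷ suc n ∷ suc n ∷ suc n ∷ n + 0 ∷ []
    ≡⟨ cong (λ g → suc n ∷ suc n ∷ suc n ∷ suc n ∷ g ∷ []) (+-identityʳ n) ⟩
  suc n ∷ suc n ∷ suc n ∷ suc n ∷ n ∷ [] ∎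
  where
  open ≡-Reasoning
  profile-block : profile (block n) ≡ withB (suc n) [] 0
  profile-block = trans (profile-++ (replicate (suc n) a) (b ∷ []))
                   (trans (cong (_· withB 0 [] 0) (profile-aⁿ (suc n))) (cong (λ f → withB f [] 0) (+-identityʳ (suc n))))

witness-base : ∀ n → BaseGaps n (cyclicGaps (profile (witness n)))
witness-base n rewrite cyclicGaps-witness n = record
  { length≡5  = refl
  ; sum≡      = total n
  ; bounds    = full ∷ full ∷ full ∷ full ∷ (≤-refl , n≤1+n n) ∷ []
  ; four-full = trans (count-++ (suc n ≤?_) (suc n ∷ suc n ∷ suc n ∷ suc n ∷ []) (n ∷ []))
                  (cong₂ _+_ (cong length (filter-all (suc n ≤?_) (≤-refl ∷ ≤-refl ∷ ≤-refl ∷ ≤-refl ∷ [])))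
                             (count-reject (suc n ≤?_) (<⇒≱ ≤-refl))) }
  where
  total : ∀ n → suc (suc n + (suc n + (suc n + (suc n + (n + 0))))) ≡ 5 * suc n
  total = solve-∀
  full : n ≤ suc n × suc n ≤ suc n
  full = n≤1+n n , ≤-refl

witness-primitive : ∀ n → Primitive (witness n)
witness-primitive n = nonempty , not-power
  where
  nonempty : witness n ≢ []
  nonempty eq with () ← ++-conicalʳ (replicate n a) _ eq
  one-short : count (_≤? n) (cyclicGaps (profile (witness n))) ≡ 1
  one-short rewrite cyclicGaps-witness n =
    trans (count-++ (_≤? n) (suc n ∷ suc n ∷ suc n ∷ suc n ∷ []) (n ∷ []))
          (cong₂ _+_ (cong length (filter-none (_≤? n) (1+n≰n ∷ 1+n≰n ∷ 1+n≰n ∷ 1+n≰n ∷ [])))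
                     (count-accept (_≤? n) ≤-refl))
  not-power : ¬ Σ Word λ v → Σ ℕ λ k → (2 ≤ k) × (witness n ≡ v ^ k)
  not-power (v , k , 2≤k , eq) =
    count-^*-≢-1 (_≤? n) (cyclicGaps (profile v)) k (trans (cong (cyclicGaps ∘ profile) eq) (cyclicGaps-^ v k)) 2≤k one-short

witness-QIbar : ∀ n → QIbar (witness n)
witness-QIbar n = witness-primitive n , λ (_ , robust) →
  proj₂ (robust 0 z≤n a) (block n , 5 , s≤s (s≤s z≤n) , cong (a ∷_) (sym (++-assoc (replicate n a) (b ∷ []) _)))

n≤length-witness : ∀ n → n ≤ length (witness n)
n≤length-witness n = ≤-trans (≤-reflexive (sym (length-replicate n))) (≤-trans (m≤m+n _ _) (≤-reflexive (sym (length-++ (replicate n a)))))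

deleted-witness-insertion-primitive : ∀ p u v x y z → witness (p + p + 3) ≡ u ++ (v ++ x ++ y) ++ z →
                                      length (v ++ x ++ y) ≤ p → 1 ≤ length (v ++ y) →
                                      ∀ i c → Primitive (insertAt i c (u ++ x ++ z))
deleted-witness-insertion-primitive p u v x y z split |vxy|≤p 1≤|vy| =
  insertion-primitive n+1<2t (u ++ x ++ z)
    (Deletion.deletion-robust p+3≤n t+p≤n u v x y z
      (subst (BaseGaps n ∘ cyclicGaps ∘ profile) split (witness-base n)) |vxy|≤p 1≤|vy|)
  where
  n t : ℕ
  n = p + p + 3
  t = p + 3
  p+3≤n : p + 3 ≤ n
  p+3≤n = +-monoˡ-≤ 3 (m≤m+n p p)
  t+p≤n : t + p ≤ n
  t+p≤n = ≤-reflexive (trans (+-assoc p 3 p) (trans (cong (p +_) (+-comm 3 p)) (sym (+-assoc p p 3))))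
  n+1<2t : suc n < t + t
  n+1<2t = ≤-trans (n≤1+n _) (≤-reflexive (arith p))
    where
    arith : ∀ p → 3 + (p + p + 3) ≡ p + 3 + (p + 3)
    arith = solve-∀

theorem22 : ¬ ContextFree QIbar
theorem22 (G , G⇔QIbar) =
  proj₂ uxz∈QIbar (proj₁ uxz∈QIbar , λ i _ c → deleted-witness-insertion-primitive p u v x y z split |vxy|≤p vy≢ε i c)
  where
  p : ℕ
  p = proj₁ (pumping-lemma G)
  w : Word
  w = witness (p + p + 3)
  p≤|w| : p ≤ length w
  p≤|w| = ≤-trans (≤-trans (m≤m+n p p) (m≤m+n (p + p) 3)) (n≤length-witness (p + p + 3))
  open PumpingDecomposition (proj₂ (pumping-lemma G) w (Equivalence.from (G⇔QIbar w) (witness-QIbar _)) p≤|w|)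
  uxz∈QIbar : QIbar (u ++ x ++ z)
  uxz∈QIbar = Equivalence.to (G⇔QIbar _) (subst (Lang G) (cong (λ x′ → u ++ x′ ++ z) (++-identityʳ x)) (pump 0))
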